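{- Let $X$ be a type. (a) If $\mathrm{int}:\mathcal P(X)\to\mathcal P(X)$ is a Moore interior operator, then $\mathcal O_{\mathrm{int}}:=\{s:\mathcal P(X)\mid s\subseteq \mathrm{int}\, s\}$ is a Moore collection of open subsets. Conversely, if $\mathcal O:\mathcal P(\mathcal P(X))$ is a Moore collection of open subsets, then $\mathrm{int}_{\mathcal O}\, s:=\{x:X\mid \exists t:\mathcal P(X),\ (t\in\mathcal O\otimes t\subseteq s\otimes x\in t)\}$ is a Moore interior operator. These two constructions are mutually inverse (up to logical equivalence of the resulting predicates), so Moore interior operators correspond one-to-one to Moore collections of open subsets. (b) Under this correspondence, interior operators correspond one-to-one to collections of open subsets.
   Context: Framework: constructive mathematics with affine logic as internal logic (classical linear logic with weakening but without contraction). Connectives: multiplicative conjunction $\otimes$ (unit $\top$), multiplicative disjunction written $\mathbin{\mathrm{par}}$ (unit $\bot$), additive conjunction $\mathbin{\&}$, additive disjunction $\oplus$, involutive negation $\neg$, linear implication $\multimap$, exponentials $!,?$; $\forall,\exists$ are the usual (additive) quantifiers. $\otimes,\mathbin{\&}$ bind tighter than $\mathbin{\mathrm{par}},\oplus,\multimap$, and $\multimap$ associates to the right. $\Omega$ is the type of propositions, assumed impredicative (propositions quantifying over $\Omega$ are in $\Omega$). For a type $X$, $\mathcal P(X):=X\to\Omega$; every such function is a subset. Write $x\in s$ for $s(x)$, $x\notin s$ for $\neg s(x)$; $s\subseteq t:=\forall x{:}X,(x\in s\multimap x\in t)$; $s\boxtimes t:=\{x\mid x\in s\otimes x\in t\}$;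 $s\sqcap t:=\{x\mid x\in s\mathbin{\&} x\in t\}$; $X$ also denotes the subset $\{x\mid\top\}$. An operator $\mathrm{int}:\mathcal P(X)\to\mathcal P(X)$ is a Moore interior operator if (I1) $\forall s,\ \mathrm{int}\,s\subseteq s$; (I2) $\forall s,t,\ (s\subseteq t\multimap \mathrm{int}\,s\subseteq\mathrm{int}\,t)$; (I3) $\forall s,\ \mathrm{int}\,s\subseteq\mathrm{int}(\mathrm{int}\,s)$. It is an interior operator if moreover (I4) $X\subseteq\mathrm{int}\,X$ and (I5) $\forall s,t,\ \mathrm{int}\,s\boxtimes\mathrm{int}\,t\subseteq\mathrm{int}(s\sqcap t)$. A Moore collection of open subsets is $\mathcal O:\mathcal P(\mathcal P(X))$ with (O1) $\forall s,t,\ (s\in\mathcal O\multimap s\subseteq t\otimes t\subseteq s\multimap t\in\mathcal O)$; (O2) $\forall s,\ \{x\mid\exists t,(t\in\mathcal O\otimes t\subseteq s\otimes x\in t)\}\in\mathcal O$. A collection of open subsets additionally satisfies (O3) $X\in\mathcal O$ and (O4) $\forall s,t,\ (s\in\mathcal O\otimes t\in\mathcal O\multimap\exists u,(u\in\mathcal O\otimes s\boxtimes t\subseteq u\otimes u\subseteq s\sqcap t))$. -}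

module Defs where

open import Data.Product using (_×_)

-- An algebraic model of (classical) affine logic with impredicative
-- quantifiers: a complete Girard quantale whose monoidal unit is the top
-- element (weakening).  Ω is the type of propositions, _≤_ is entailment,
-- ⋀ / ⋁ interpret the (additive) quantifiers ∀ / ∃ over arbitrary types
-- (impredicativity: Ω : Set, and quantification over any I : Set,
-- including I = X → Ω, stays in Ω).
record AffineLogic : Set₁ where
  infixr 7 _⊗_ _&_
  infixr 6 _⊕_
  infixr 5 _⊸_
  infix 4 _≤_
  field
    Ω     : Set
    _≤_   : Ω → Ω → Set
    ≤-refl  : ∀ {a} → a ≤ a
    ≤-trans : ∀ {a b c} → a ≤ b → b ≤ c → a ≤ c
    ⊤ ⊥   : Ω
    ⊤-max : ∀ a → a ≤ ⊤
    _⊗_   : Ω → Ω → Ω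
    _⊸_   : Ω → Ω → Ω
    ⊗-comm   : ∀ a b → a ⊗ b ≤ b ⊗ a
    ⊗-assocˡ : ∀ a b c → (a ⊗ b) ⊗ c ≤ a ⊗ (b ⊗ c)
    ⊗-assocʳ : ∀ a b c → a ⊗ (b ⊗ c) ≤ (a ⊗ b) ⊗ c
    ⊗-unitˡ  : ∀ a → a ⊗ ⊤ ≤ a
    ⊗-unitʳ  : ∀ a → a ≤ a ⊗ ⊤
    residual⇒ : ∀ a b c → a ⊗ b ≤ c → a ≤ b ⊸ c
    residual⇐ : ∀ a b c → a ≤ b ⊸ c → a ⊗ b ≤ c
    ¬¬-elim  : ∀ a → (a ⊸ ⊥) ⊸ ⊥ ≤ a
    _&_   : Ω → Ω → Ω
    _⊕_   : Ω → Ω → Ω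
    &-π₁  : ∀ a b → a & b ≤ a
    &-π₂  : ∀ a b → a & b ≤ b
    &-⟨⟩  : ∀ {a b c} → c ≤ a → c ≤ b → c ≤ a & b
    ⊕-ι₁  : ∀ a b → a ≤ a ⊕ b
    ⊕-ι₂  : ∀ a b → b ≤ a ⊕ b
    ⊕-[]  : ∀ {a b c} → a ≤ c → b ≤ c → a ⊕ b ≤ c
    ⋀     : {I : Set} → (I → Ω) → Ω
    ⋁     : {I : Set} → (I → Ω) → Ω
    ⋀-lb  : ∀ {I} (f : I → Ω) i → ⋀ f ≤ f i
    ⋀-glb : ∀ {I} (f : I → Ω) {a} → (∀ i → a ≤ f i) → a ≤ ⋀ f
    ⋁-ub  : ∀ {I} (f : I → Ω) i → f i ≤ ⋁ f
    ⋁-lub : ∀ {I} (f : I → Ω) {a} → (∀ i → f i ≤ a) → ⋁ f ≤ a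

  ¬_ : Ω → Ω
  ¬ a = a ⊸ ⊥

  infixr 6 _par_
  _par_ : Ω → Ω → Ω
  a par b = ¬ (¬ a ⊗ ¬ b)

  ∀' : (I : Set) → (I → Ω) → Ω
  ∀' I f = ⋀ {I} f
  ∃' : (I : Set) → (I → Ω) → Ω
  ∃' I f = ⋁ {I} f

  infix 5 _⟛_
  _⟛_ : Ω → Ω → Ω
  a ⟛ b = (a ⊸ b) & (b ⊸ a)

  infix 2 ⊢_
  ⊢_ : Ω → Set
  ⊢ φ = ⊤ ≤ φ

module Topology (L : AffineLogic) where
  open AffineLogic L

  𝒫 : Set → Set
  𝒫 X = X → Ω

  infix 9 _∈_
  _∈_ : {A : Set} → A → 𝒫 A → Ω
  x ∈ s = s x

  module _ {X : Set} where
    infix 9 _⊆_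
    infixr 10 _⊠_ _⊓_

    _⊆_ : 𝒫 X → 𝒫 X → Ω
    s ⊆ t = ∀' X λ x → x ∈ s ⊸ x ∈ t

    _⊠_ : 𝒫 X → 𝒫 X → 𝒫 X
    (s ⊠ t) x = x ∈ s ⊗ x ∈ t

    _⊓_ : 𝒫 X → 𝒫 X → 𝒫 X
    (s ⊓ t) x = x ∈ s & x ∈ t

    whole : 𝒫 X
    whole _ = ⊤

    record IsMooreInterior (int : 𝒫 X → 𝒫 X) : Set where
      field
        I1 : ⊢ ∀' (𝒫 X) λ s → int s ⊆ s
        I2 : ⊢ ∀' (𝒫 X) λ s → ∀' (𝒫 X) λ t → s ⊆ t ⊸ int s ⊆ int t
        I3 : ⊢ ∀' (𝒫 X) λ s → int s ⊆ int (int s)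

    record IsInterior (int : 𝒫 X → 𝒫 X) : Set where
      field
        moore : IsMooreInterior int
        I4 : ⊢ whole ⊆ int whole
        I5 : ⊢ ∀' (𝒫 X) λ s → ∀' (𝒫 X) λ t → int s ⊠ int t ⊆ int (s ⊓ t)

    ⋃open : 𝒫 (𝒫 X) → 𝒫 X → 𝒫 X
    ⋃open 𝒪 s x = ∃' (𝒫 X) λ t → t ∈ 𝒪 ⊗ t ⊆ s ⊗ x ∈ t

    record IsMooreOpens (𝒪 : 𝒫 (𝒫 X)) : Set where
      field
        O1 : ⊢ ∀' (𝒫 X) λ s → ∀' (𝒫 X) λ t →
               s ∈ 𝒪 ⊸ s ⊆ t ⊗ t ⊆ s ⊸ t ∈ 𝒪
        O2 : ⊢ ∀' (𝒫 X) λ s → ⋃open 𝒪 s ∈ 𝒪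

    record IsOpens (𝒪 : 𝒫 (𝒫 X)) : Set where
      field
        moore : IsMooreOpens 𝒪
        O3 : ⊢ whole ∈ 𝒪
        O4 : ⊢ ∀' (𝒫 X) λ s → ∀' (𝒫 X) λ t →
               s ∈ 𝒪 ⊗ t ∈ 𝒪 ⊸
               ∃' (𝒫 X) λ u → u ∈ 𝒪 ⊗ s ⊠ t ⊆ u ⊗ u ⊆ s ⊓ t

    𝒪[_] : (𝒫 X → 𝒫 X) → 𝒫 (𝒫 X)
    𝒪[ int ] s = s ⊆ int s

    int[_] : 𝒫 (𝒫 X) → 𝒫 X → 𝒫 X
    int[ 𝒪 ] = ⋃open 𝒪

  Proposition4 : Set → Set
  Proposition4 X =
      (∀ (int : 𝒫 X → 𝒫 X) → IsMooreInterior int → IsMooreOpens 𝒪[ int ])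
    ×
      (∀ (𝒪 : 𝒫 (𝒫 X)) → IsMooreOpens 𝒪 → IsMooreInterior int[ 𝒪 ])
    ×
      (∀ (int : 𝒫 X → 𝒫 X) → IsMooreInterior int →
         ⊢ ∀' (𝒫 X) λ s → ∀' X λ x → x ∈ int[ 𝒪[ int ] ] s ⟛ x ∈ int s)
    ×
      (∀ (𝒪 : 𝒫 (𝒫 X)) → IsMooreOpens 𝒪 →
         ⊢ ∀' (𝒫 X) λ s → s ∈ 𝒪[ int[ 𝒪 ] ] ⟛ s ∈ 𝒪)
    ×
      (∀ (int : 𝒫 X → 𝒫 X) → IsInterior int → IsOpens 𝒪[ int ])
    ×
      (∀ (𝒪 : 𝒫 (𝒫 X)) → IsOpens 𝒪 → IsInterior int[ 𝒪 ])

{-# OPTIONS --safe #-}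
module Submission where

open import Data.Product using (_,_)
import Relation.Binary.Reasoning.Base.Single as SingleRelationReasoning
open import Relation.Binary.Reasoning.Syntax using (module ≤-syntax)

open import Defs

-- Without contraction every hypothesis may be used only once, so each
-- argument is a chain of entailments in which hypotheses are consumed in
-- turn, while theorems (⊢ φ), such as the axioms, can be added at will.
--
-- For a Moore interior operator, int s is open (I3) and contained in s (I1),
-- and every open t ⊆ s lies in int s (I2), so int s is the union of the opens
-- inside s.  For a Moore collection, ⋃open 𝒪 s is open (O2) and contained in
-- s, so s ⊆ ⋃open 𝒪 s makes s open by O1.  For (b), I5 yields O4 with the
-- witness u = int (s ⊓ t); conversely, O4 applied to the opens witnessing
-- x ∈ int s and x ∈ int t yields I5.

module AffineLogicProperties (L : AffineLogic) where
  open AffineLogic L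

  module ≤-Reasoning where
    open SingleRelationReasoning _≤_ ≤-refl ≤-trans public using (begin_; _∎)
    open SingleRelationReasoning _≤_ ≤-refl ≤-trans using (_IsRelatedTo_; ∼-go)
    open ≤-syntax _IsRelatedTo_ _IsRelatedTo_ ∼-go public

  open ≤-Reasoning

  ⊗-monoˡ : ∀ {a a′ b} → a ≤ a′ → a ⊗ b ≤ a′ ⊗ b
  ⊗-monoˡ {a} {a′} {b} p = residual⇐ a b (a′ ⊗ b) (≤-trans p (residual⇒ a′ b (a′ ⊗ b) ≤-refl))

  ⊗-monoʳ : ∀ {a b b′} → b ≤ b′ → a ⊗ b ≤ a ⊗ b′
  ⊗-monoʳ {a} {b} {b′} p = begin
    a ⊗ b   ≤⟨ ⊗-comm a b ⟩
    b ⊗ a   ≤⟨ ⊗-monoˡ p ⟩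
    b′ ⊗ a  ≤⟨ ⊗-comm b′ a ⟩
    a ⊗ b′  ∎

  ⊗-mono : ∀ {a a′ b b′} → a ≤ a′ → b ≤ b′ → a ⊗ b ≤ a′ ⊗ b′
  ⊗-mono p q = ≤-trans (⊗-monoˡ p) (⊗-monoʳ q)

  ⊗-π₁ : ∀ {a b} → a ⊗ b ≤ a
  ⊗-π₁ {a} {b} = ≤-trans (⊗-monoʳ (⊤-max b)) (⊗-unitˡ a)

  ⊗-π₂ : ∀ {a b} → a ⊗ b ≤ b
  ⊗-π₂ {a} {b} = ≤-trans (⊗-comm a b) ⊗-π₁

  ⊗-exchange : ∀ {a b c} → a ⊗ (b ⊗ c) ≤ b ⊗ (a ⊗ c)
  ⊗-exchange {a} {b} {c} = begin
    a ⊗ (b ⊗ c)  ≤⟨ ⊗-assocʳ a b c ⟩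
    (a ⊗ b) ⊗ c  ≤⟨ ⊗-monoˡ (⊗-comm a b) ⟩
    (b ⊗ a) ⊗ c  ≤⟨ ⊗-assocˡ b a c ⟩
    b ⊗ (a ⊗ c)  ∎

  ⊗-interchange : ∀ {a b c d} → (a ⊗ b) ⊗ (c ⊗ d) ≤ (a ⊗ c) ⊗ (b ⊗ d)
  ⊗-interchange {a} {b} {c} {d} = begin
    (a ⊗ b) ⊗ (c ⊗ d)  ≤⟨ ⊗-assocˡ a b (c ⊗ d) ⟩
    a ⊗ (b ⊗ (c ⊗ d))  ≤⟨ ⊗-monoʳ ⊗-exchange ⟩
    a ⊗ (c ⊗ (b ⊗ d))  ≤⟨ ⊗-assocʳ a c (b ⊗ d) ⟩
    (a ⊗ c) ⊗ (b ⊗ d)  ∎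

  ⊸-eval : ∀ {a b} → (a ⊸ b) ⊗ a ≤ b
  ⊸-eval {a} {b} = residual⇐ (a ⊸ b) a b ≤-refl

  ⋁-⊗-lub : ∀ {I} {f : I → Ω} {a c} → (∀ i → f i ⊗ a ≤ c) → ⋁ f ⊗ a ≤ c
  ⋁-⊗-lub {f = f} {a} {c} h = residual⇐ (⋁ f) a c (⋁-lub f λ i → residual⇒ (f i) a c (h i))

  ⊗-⋁-lub : ∀ {I} {f : I → Ω} {a c} → (∀ i → a ⊗ f i ≤ c) → a ⊗ ⋁ f ≤ c
  ⊗-⋁-lub {f = f} {a} h =
    ≤-trans (⊗-comm a (⋁ f)) (⋁-⊗-lub λ i → ≤-trans (⊗-comm (f i) a) (h i))

  ⊢-∀-elim : ∀ {I} {f : I → Ω} i → ⊢ ⋀ f → ⊢ f i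
  ⊢-∀-elim {f = f} i p = ≤-trans p (⋀-lb f i)

  ⊢-⊗-introˡ : ∀ {a b} → ⊢ a → b ≤ a ⊗ b
  ⊢-⊗-introˡ {a} {b} p = ≤-trans (⊗-unitʳ b) (≤-trans (⊗-monoʳ p) (⊗-comm b a))

  ⊢-⊗-introʳ : ∀ {a b} → ⊢ b → a ≤ a ⊗ b
  ⊢-⊗-introʳ {a} p = ≤-trans (⊗-unitʳ a) (⊗-monoʳ p)

  ⊢-⊸-intro : ∀ {a b} → a ≤ b → ⊢ a ⊸ b
  ⊢-⊸-intro {a} {b} p = residual⇒ ⊤ a b (≤-trans ⊗-π₂ p)

  ⊢-⊸-elim : ∀ {a b} → ⊢ a ⊸ b → a ≤ b
  ⊢-⊸-elim p = ≤-trans (⊢-⊗-introˡ p) ⊸-eval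

  ⊢-⊸-intro₂ : ∀ {a b c} → a ⊗ b ≤ c → ⊢ a ⊸ b ⊸ c
  ⊢-⊸-intro₂ {a} {b} {c} p = ⊢-⊸-intro (residual⇒ a b c p)

  ⊢-⊸-elim₂ : ∀ {a b c} → ⊢ a ⊸ b ⊸ c → a ⊗ b ≤ c
  ⊢-⊸-elim₂ {a} {b} {c} p = residual⇐ a b c (⊢-⊸-elim p)

  ⊢-⟛-intro : ∀ {a b} → a ≤ b → b ≤ a → ⊢ a ⟛ b
  ⊢-⟛-intro p q = &-⟨⟩ (⊢-⊸-intro p) (⊢-⊸-intro q)

module SubsetProperties (L : AffineLogic) {X : Set} where
  open AffineLogic L
  open Topology L
  open AffineLogicProperties L
  open ≤-Reasoning

  ⊆-intro : ∀ {a} {s t : 𝒫 X} → (∀ x → a ⊗ x ∈ s ≤ x ∈ t) → a ≤ s ⊆ t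
  ⊆-intro {a} {s} {t} h = ⋀-glb _ λ x → residual⇒ a (x ∈ s) (x ∈ t) (h x)

  ⊢-⊆-intro : ∀ {s t : 𝒫 X} → (∀ x → x ∈ s ≤ x ∈ t) → ⊢ s ⊆ t
  ⊢-⊆-intro h = ⊆-intro λ x → ≤-trans ⊗-π₂ (h x)

  ⊆-apply : ∀ {s t : 𝒫 X} x → s ⊆ t ⊗ x ∈ s ≤ x ∈ t
  ⊆-apply x = ≤-trans (⊗-monoˡ (⋀-lb _ x)) ⊸-eval

  ⊆-refl : ∀ {s : 𝒫 X} → ⊢ s ⊆ s
  ⊆-refl = ⊢-⊆-intro λ _ → ≤-refl

  ⊆-trans : ∀ {s t u : 𝒫 X} → s ⊆ t ⊗ t ⊆ u ≤ s ⊆ u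
  ⊆-trans {s} {t} {u} = ⊆-intro λ x → begin
    (s ⊆ t ⊗ t ⊆ u) ⊗ x ∈ s  ≤⟨ ⊗-monoˡ (⊗-comm (s ⊆ t) (t ⊆ u)) ⟩
    (t ⊆ u ⊗ s ⊆ t) ⊗ x ∈ s  ≤⟨ ⊗-assocˡ (t ⊆ u) (s ⊆ t) (x ∈ s) ⟩
    t ⊆ u ⊗ s ⊆ t ⊗ x ∈ s    ≤⟨ ⊗-monoʳ (⊆-apply x) ⟩
    t ⊆ u ⊗ x ∈ t            ≤⟨ ⊆-apply x ⟩
    x ∈ u                    ∎

  ⊢-⊆-trans : ∀ {s t u : 𝒫 X} → ⊢ s ⊆ t → ⊢ t ⊆ u → ⊢ s ⊆ u
  ⊢-⊆-trans p q = ≤-trans p (≤-trans (⊢-⊗-introʳ q) ⊆-trans)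

  ⊆-antisym : ∀ {s t : 𝒫 X} → ⊢ s ⊆ t → ⊢ t ⊆ s → ⊢ ∀' X λ x → x ∈ s ⟛ x ∈ t
  ⊆-antisym p q = ⋀-glb _ λ x → &-⟨⟩ (⊢-∀-elim x p) (⊢-∀-elim x q)

  ⊠-mono : ∀ {s s′ t t′ : 𝒫 X} → s ⊆ s′ ⊗ t ⊆ t′ ≤ s ⊠ t ⊆ s′ ⊠ t′
  ⊠-mono = ⊆-intro λ x → ≤-trans ⊗-interchange (⊗-mono (⊆-apply x) (⊆-apply x))

  ⊓-mono : ∀ {s s′ t t′ : 𝒫 X} → s ⊆ s′ ⊗ t ⊆ t′ ≤ s ⊓ t ⊆ s′ ⊓ t′
  ⊓-mono = ⊆-intro λ x →
    &-⟨⟩ (≤-trans (⊗-mono ⊗-π₁ (&-π₁ _ _)) (⊆-apply x))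
         (≤-trans (⊗-mono ⊗-π₂ (&-π₂ _ _)) (⊆-apply x))

module Correspondence (L : AffineLogic) {X : Set} where
  open AffineLogic L
  open Topology L
  open AffineLogicProperties L
  open SubsetProperties L {X}
  open ≤-Reasoning

  module UnionOfOpens (𝒪 : 𝒫 (𝒫 X)) where

    ⋃open-⊆ : ∀ {s} → ⊢ ⋃open 𝒪 s ⊆ s
    ⋃open-⊆ = ⊢-⊆-intro λ x → ⋁-lub _ λ t → ≤-trans ⊗-π₂ (⊆-apply x)

    ⋃open-mono : ∀ {s t} → s ⊆ t ≤ ⋃open 𝒪 s ⊆ ⋃open 𝒪 t
    ⋃open-mono {s} {t} = ⊆-intro λ x → ⊗-⋁-lub λ u → begin
      s ⊆ t ⊗ u ∈ 𝒪 ⊗ u ⊆ s ⊗ x ∈ u      ≤⟨ ⊗-exchange ⟩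
      u ∈ 𝒪 ⊗ s ⊆ t ⊗ u ⊆ s ⊗ x ∈ u      ≤⟨ ⊗-monoʳ (⊗-assocʳ (s ⊆ t) (u ⊆ s) (x ∈ u)) ⟩
      u ∈ 𝒪 ⊗ (s ⊆ t ⊗ u ⊆ s) ⊗ x ∈ u    ≤⟨ ⊗-monoʳ (⊗-monoˡ (⊗-comm (s ⊆ t) (u ⊆ s))) ⟩
      u ∈ 𝒪 ⊗ (u ⊆ s ⊗ s ⊆ t) ⊗ x ∈ u    ≤⟨ ⊗-monoʳ (⊗-monoˡ ⊆-trans) ⟩
      u ∈ 𝒪 ⊗ u ⊆ t ⊗ x ∈ u              ≤⟨ ⋁-ub _ u ⟩
      x ∈ ⋃open 𝒪 t                       ∎

    ⊆-⋃open : ∀ {s t} → t ∈ 𝒪 ⊗ t ⊆ s ≤ t ⊆ ⋃open 𝒪 s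
    ⊆-⋃open {s} {t} = ⊆-intro λ x → ≤-trans (⊗-assocˡ (t ∈ 𝒪) (t ⊆ s) (x ∈ t)) (⋁-ub _ t)

    open⇒⊆⋃open : ∀ {t} → t ∈ 𝒪 ≤ t ⊆ ⋃open 𝒪 t
    open⇒⊆⋃open = ≤-trans (⊢-⊗-introʳ ⊆-refl) ⊆-⋃open

  module MooreOpens {𝒪 : 𝒫 (𝒫 X)} (M : IsMooreOpens 𝒪) where
    open IsMooreOpens M
    open UnionOfOpens 𝒪 public

    ⋃open-open : ∀ {s} → ⊢ ⋃open 𝒪 s ∈ 𝒪
    ⋃open-open {s} = ⊢-∀-elim s O2

    ⊆⋃open⇒open : ∀ {s} → s ⊆ ⋃open 𝒪 s ≤ s ∈ 𝒪
    ⊆⋃open⇒open {s} = begin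
      s ⊆ ⋃open 𝒪 s                                      ≤⟨ ⊢-⊗-introˡ ⋃open-⊆ ⟩
      ⋃open 𝒪 s ⊆ s ⊗ s ⊆ ⋃open 𝒪 s                      ≤⟨ ⊢-⊗-introˡ ⋃open-open ⟩
      ⋃open 𝒪 s ∈ 𝒪 ⊗ ⋃open 𝒪 s ⊆ s ⊗ s ⊆ ⋃open 𝒪 s     ≤⟨ ⊢-⊸-elim₂ (⊢-∀-elim s (⊢-∀-elim (⋃open 𝒪 s) O1)) ⟩
      s ∈ 𝒪                                              ∎

    int[]-isMooreInterior : IsMooreInterior int[ 𝒪 ]
    int[]-isMooreInterior = record
      { I1 = ⋀-glb _ λ _ → ⋃open-⊆
      ; I2 = ⋀-glb _ λ _ → ⋀-glb _ λ _ → ⊢-⊸-intro ⋃open-mono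
      ; I3 = ⋀-glb _ λ _ → ≤-trans ⋃open-open open⇒⊆⋃open
      }

    𝒪[int[]]⟛𝒪 : ⊢ ∀' (𝒫 X) λ s → s ∈ 𝒪[ int[ 𝒪 ] ] ⟛ s ∈ 𝒪
    𝒪[int[]]⟛𝒪 = ⋀-glb _ λ _ → ⊢-⟛-intro ⊆⋃open⇒open open⇒⊆⋃open

  module Opens {𝒪 : 𝒫 (𝒫 X)} (O : IsOpens 𝒪) where
    open IsOpens O
    open MooreOpens moore

    ⊠-⊆-⋃open-⊓ : ∀ {s t} → s ∈ 𝒪 ⊗ t ∈ 𝒪 ≤ s ⊠ t ⊆ ⋃open 𝒪 (s ⊓ t)
    ⊠-⊆-⋃open-⊓ {s} {t} = ≤-trans (⊢-⊸-elim (⊢-∀-elim t (⊢-∀-elim s O4))) (⋁-lub _ λ u → begin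
      u ∈ 𝒪 ⊗ s ⊠ t ⊆ u ⊗ u ⊆ s ⊓ t      ≤⟨ ⊗-monoʳ (⊗-comm (s ⊠ t ⊆ u) (u ⊆ s ⊓ t)) ⟩
      u ∈ 𝒪 ⊗ u ⊆ s ⊓ t ⊗ s ⊠ t ⊆ u      ≤⟨ ⊗-assocʳ (u ∈ 𝒪) (u ⊆ s ⊓ t) (s ⊠ t ⊆ u) ⟩
      (u ∈ 𝒪 ⊗ u ⊆ s ⊓ t) ⊗ s ⊠ t ⊆ u    ≤⟨ ⊗-monoˡ ⊆-⋃open ⟩
      u ⊆ ⋃open 𝒪 (s ⊓ t) ⊗ s ⊠ t ⊆ u    ≤⟨ ⊗-comm (u ⊆ ⋃open 𝒪 (s ⊓ t)) (s ⊠ t ⊆ u) ⟩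
      s ⊠ t ⊆ u ⊗ u ⊆ ⋃open 𝒪 (s ⊓ t)    ≤⟨ ⊆-trans ⟩
      s ⊠ t ⊆ ⋃open 𝒪 (s ⊓ t)            ∎)

    ⋃open-⊠ : ∀ {s t} → ⊢ ⋃open 𝒪 s ⊠ ⋃open 𝒪 t ⊆ ⋃open 𝒪 (s ⊓ t)
    ⋃open-⊠ {s} {t} = ⊢-⊆-intro λ x → ⋁-⊗-lub λ a → ⊗-⋁-lub λ b → begin
      (a ∈ 𝒪 ⊗ a ⊆ s ⊗ x ∈ a) ⊗ (b ∈ 𝒪 ⊗ b ⊆ t ⊗ x ∈ b)
        ≤⟨ ⊗-interchange ⟩
      (a ∈ 𝒪 ⊗ b ∈ 𝒪) ⊗ (a ⊆ s ⊗ x ∈ a) ⊗ (b ⊆ t ⊗ x ∈ b)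
        ≤⟨ ⊗-monoʳ ⊗-interchange ⟩
      (a ∈ 𝒪 ⊗ b ∈ 𝒪) ⊗ (a ⊆ s ⊗ b ⊆ t) ⊗ x ∈ a ⊠ b
        ≤⟨ ⊗-assocʳ (a ∈ 𝒪 ⊗ b ∈ 𝒪) (a ⊆ s ⊗ b ⊆ t) (x ∈ a ⊠ b) ⟩
      ((a ∈ 𝒪 ⊗ b ∈ 𝒪) ⊗ (a ⊆ s ⊗ b ⊆ t)) ⊗ x ∈ a ⊠ b
        ≤⟨ ⊗-monoˡ (⊗-mono ⊠-⊆-⋃open-⊓ (≤-trans ⊓-mono ⋃open-mono)) ⟩
      (a ⊠ b ⊆ ⋃open 𝒪 (a ⊓ b) ⊗ ⋃open 𝒪 (a ⊓ b) ⊆ ⋃open 𝒪 (s ⊓ t)) ⊗ x ∈ a ⊠ b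
        ≤⟨ ⊗-monoˡ ⊆-trans ⟩
      a ⊠ b ⊆ ⋃open 𝒪 (s ⊓ t) ⊗ x ∈ a ⊠ b
        ≤⟨ ⊆-apply x ⟩
      x ∈ ⋃open 𝒪 (s ⊓ t)
        ∎

    int[]-isInterior : IsInterior int[ 𝒪 ]
    int[]-isInterior = record
      { moore = int[]-isMooreInterior
      ; I4    = ≤-trans O3 open⇒⊆⋃open
      ; I5    = ⋀-glb _ λ _ → ⋀-glb _ λ _ → ⋃open-⊠
      }

  module MooreInterior {int : 𝒫 X → 𝒫 X} (M : IsMooreInterior int) where
    open IsMooreInterior M
    open UnionOfOpens 𝒪[ int ]

    int-⊆ : ∀ {s} → ⊢ int s ⊆ s
    int-⊆ {s} = ⊢-∀-elim s I1

    int-mono : ∀ {s t} → s ⊆ t ≤ int s ⊆ int t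
    int-mono {s} {t} = ⊢-⊸-elim (⊢-∀-elim t (⊢-∀-elim s I2))

    int-open : ∀ {s} → ⊢ int s ∈ 𝒪[ int ]
    int-open {s} = ⊢-∀-elim s I3

    ⋃open-⊆-int : ∀ {s} → ⊢ int[ 𝒪[ int ] ] s ⊆ int s
    ⋃open-⊆-int {s} = ⊢-⊆-intro λ x → ⋁-lub _ λ t → begin
      t ⊆ int t ⊗ t ⊆ s ⊗ x ∈ t              ≤⟨ ⊗-assocʳ (t ⊆ int t) (t ⊆ s) (x ∈ t) ⟩
      (t ⊆ int t ⊗ t ⊆ s) ⊗ x ∈ t            ≤⟨ ⊗-monoˡ (⊗-monoʳ int-mono) ⟩
      (t ⊆ int t ⊗ int t ⊆ int s) ⊗ x ∈ t    ≤⟨ ⊗-monoˡ ⊆-trans ⟩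
      t ⊆ int s ⊗ x ∈ t                      ≤⟨ ⊆-apply x ⟩
      x ∈ int s                              ∎

    int-⊆-⋃open : ∀ {s} → ⊢ int s ⊆ int[ 𝒪[ int ] ] s
    int-⊆-⋃open = ≤-trans int-open (≤-trans (⊢-⊗-introʳ int-⊆) ⊆-⋃open)

    ∈𝒪[]-resp-⊆⊇ : ∀ {s t} → s ∈ 𝒪[ int ] ⊗ s ⊆ t ⊗ t ⊆ s ≤ t ∈ 𝒪[ int ]
    ∈𝒪[]-resp-⊆⊇ {s} {t} = begin
      s ⊆ int s ⊗ s ⊆ t ⊗ t ⊆ s              ≤⟨ ⊗-monoʳ (⊗-monoˡ int-mono) ⟩
      s ⊆ int s ⊗ int s ⊆ int t ⊗ t ⊆ s      ≤⟨ ⊗-assocʳ (s ⊆ int s) (int s ⊆ int t) (t ⊆ s) ⟩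
      (s ⊆ int s ⊗ int s ⊆ int t) ⊗ t ⊆ s    ≤⟨ ⊗-monoˡ ⊆-trans ⟩
      s ⊆ int t ⊗ t ⊆ s                      ≤⟨ ⊗-comm (s ⊆ int t) (t ⊆ s) ⟩
      t ⊆ s ⊗ s ⊆ int t                      ≤⟨ ⊆-trans ⟩
      t ⊆ int t                              ∎

    𝒪[]-isMooreOpens : IsMooreOpens 𝒪[ int ]
    𝒪[]-isMooreOpens = record
      { O1 = ⋀-glb _ λ _ → ⋀-glb _ λ _ → ⊢-⊸-intro₂ ∈𝒪[]-resp-⊆⊇
      ; O2 = ⋀-glb _ λ _ →
          ⊢-⊆-trans ⋃open-⊆-int (⊢-⊆-trans int-open (≤-trans int-⊆-⋃open int-mono))
      }

    int[𝒪[]]⟛int : ⊢ ∀' (𝒫 X) λ s → ∀' X λ x → x ∈ int[ 𝒪[ int ] ] s ⟛ x ∈ int s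
    int[𝒪[]]⟛int = ⋀-glb _ λ _ → ⊆-antisym ⋃open-⊆-int int-⊆-⋃open

  module Interior {int : 𝒫 X → 𝒫 X} (I : IsInterior int) where
    open IsInterior I
    open MooreInterior moore

    ⊠-⊆-int-⊓ : ∀ {s t} → s ∈ 𝒪[ int ] ⊗ t ∈ 𝒪[ int ] ≤ s ⊠ t ⊆ int (s ⊓ t)
    ⊠-⊆-int-⊓ {s} {t} = begin
      s ⊆ int s ⊗ t ⊆ int t                                  ≤⟨ ⊠-mono ⟩
      s ⊠ t ⊆ int s ⊠ int t                                  ≤⟨ ⊢-⊗-introʳ (⊢-∀-elim t (⊢-∀-elim s I5)) ⟩
      s ⊠ t ⊆ int s ⊠ int t ⊗ int s ⊠ int t ⊆ int (s ⊓ t)    ≤⟨ ⊆-trans ⟩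
      s ⊠ t ⊆ int (s ⊓ t)                                    ∎

    𝒪[]-isOpens : IsOpens 𝒪[ int ]
    𝒪[]-isOpens = record
      { moore = 𝒪[]-isMooreOpens
      ; O3    = I4
      ; O4    = ⋀-glb _ λ s → ⋀-glb _ λ t → ⊢-⊸-intro
          (≤-trans ⊠-⊆-int-⊓ (≤-trans (⊢-⊗-introʳ int-⊆)
            (≤-trans (⊢-⊗-introˡ int-open) (⋁-ub _ (int (s ⊓ t))))))
      }

proposition4 : (L : AffineLogic) (X : Set) → Topology.Proposition4 L X
proposition4 L X =
    (λ _ → MooreInterior.𝒪[]-isMooreOpens)
  , (λ _ → MooreOpens.int[]-isMooreInterior)
  , (λ _ → MooreInterior.int[𝒪[]]⟛int)
  , (λ _ → MooreOpens.𝒪[int[]]⟛𝒪)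
  , (λ _ → Interior.𝒪[]-isOpens)
  , (λ _ → Opens.int[]-isInterior)
  where open Correspondence L {X}
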